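{- Let $n>0$. Then the partitions $(n)$ and $(1^n)$ are $\mathcal N$-positions of LCTR, and $\mathrm{SG}(n)=\mathrm{SG}(1^n)=1$ if $n$ is odd and $=2$ if $n$ is even.
   Context: $(1^n)$ denotes the partition with $n$ parts equal to $1$. LCTR: positions are partitions (finite weakly decreasing sequences of positive integers); from nonempty $\lambda=(\lambda_1,\dots,\lambda_k)$ one may move to $T(\lambda)=(\lambda_2,\dots,\lambda_k)$ or $L(\lambda)=(\lambda_1-1,\dots,\lambda_k-1)$ (nonpositive entries omitted); $()$ has no moves; normal play (the last player to move wins). An $\mathcal N$-position is one from which the next player to move has a winning strategy. $\mathrm{SG}(())=0$, $\mathrm{SG}(\lambda)=\mathrm{mex}\{\mathrm{SG}(L(\lambda)),\mathrm{SG}(T(\lambda))\}$ otherwise, with $\mathrm{mex}(B)$ the least nonnegative integer not in $B$. -}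

module Defs where

open import Data.Nat using (ℕ; zero; suc; _+_; _≡ᵇ_)
open import Data.Bool using (Bool; true; false; if_then_else_; _∨_)
open import Data.List using (List; []; _∷_; length)
open import Data.Nat.ListAction using (sum)
open import Data.Product using (Σ; _×_)

-- Positions of LCTR: partitions, represented as lists of naturals
-- (weakly decreasing, positive entries).
Position : Set
Position = List ℕ

shrink : List ℕ → List ℕ
shrink []            = []
shrink (zero ∷ xs)   = shrink xs
shrink (suc zero ∷ xs) = shrink xs
shrink (suc (suc k) ∷ xs) = suc k ∷ shrink xs

T : ℕ → List ℕ → Position
T x xs = xs

L : ℕ → List ℕ → Position
L x xs = shrink (x ∷ xs)

data Move : Position → Position → Set where
  moveT : ∀ x xs → Move (x ∷ xs) (T x xs)
  moveL : ∀ x xs → Move (x ∷ xs) (L x xs)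

-- N-positions (next player wins) and P-positions (previous player wins),
-- normal play.  The game is finite, so these inductive definitions are exact.
mutual
  data IsN : Position → Set where
    win : ∀ {p q} → Move p q → IsP q → IsN p

  data IsP : Position → Set where
    lose : ∀ {p} → (∀ q → Move p q → IsN q) → IsP p

_∈₂_,_ : ℕ → ℕ → ℕ → Bool
k ∈₂ a , b = (k ≡ᵇ a) ∨ (k ≡ᵇ b)

mex₂ : ℕ → ℕ → ℕ
mex₂ a b = if (0 ∈₂ a , b) then (if (1 ∈₂ a , b) then 2 else 1) else 0

-- Sprague–Grundy value, by recursion on a fuel bound (sum + length decreases
-- strictly under both moves)
SG-fuel : ℕ → Position → ℕ
SG-fuel _       []       = 0
SG-fuel zero    (x ∷ xs) = 0
SG-fuel (suc f) (x ∷ xs) = mex₂ (SG-fuel f (L x xs)) (SG-fuel f (T x xs))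

SG : Position → ℕ
SG p = SG-fuel (sum p + length p) p

-- Both (n) and (1ⁿ) move to (): by T from (n), by L from (1ⁿ). Their other move
-- leads to (n-1) resp. (1ⁿ⁻¹), so both families have the Grundy values
-- gₙ = mex {0, gₙ₋₁} with g₀ = 0, i.e. 1, 2, 1, 2, … .
module Submission where

open import Defs
open import Data.Nat using (ℕ; zero; suc; _+_; _<_; _≤_; _%_; _≡ᵇ_; s≤s)
open import Data.Nat.Properties using (m≤m+n; m≤n+m; ≤-trans)
open import Data.Nat.ListAction using (sum)
open import Data.List using ([]; _∷_; replicate)
open import Data.List.Properties using (length-replicate)
open import Data.Product using (_×_; _,_; proj₁; proj₂)
open import Data.Bool.Properties using (∨-comm)
open import Relation.Binary.PropositionalEquality using (_≡_; refl; cong; subst; sym; trans)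

mex₂-comm : ∀ a b → mex₂ a b ≡ mex₂ b a
mex₂-comm a b rewrite ∨-comm (0 ≡ᵇ a) (0 ≡ᵇ b) | ∨-comm (1 ≡ᵇ a) (1 ≡ᵇ b) = refl

IsP-[] : IsP []
IsP-[] = lose (λ _ ())

IsN-if-Move-[] : ∀ {p} → Move p [] → IsN p
IsN-if-Move-[] m = win m IsP-[]

shrink-replicate-1 : ∀ n → shrink (replicate n 1) ≡ []
shrink-replicate-1 zero    = refl
shrink-replicate-1 (suc n) = shrink-replicate-1 n

grundy : ℕ → ℕ
grundy zero    = 0
grundy (suc n) = mex₂ 0 (grundy n)

grundy-parity : ∀ n → (suc n % 2 ≡ 1 → grundy (suc n) ≡ 1)
                    × (suc n % 2 ≡ 0 → grundy (suc n) ≡ 2)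
grundy-parity zero          = (λ _ → refl) , (λ ())
grundy-parity (suc zero)    = (λ ()) , (λ _ → refl)
grundy-parity (suc (suc n)) with grundy-parity n
... | odd , even = (λ e → cong (λ g → mex₂ 0 (mex₂ 0 g)) (odd e))
                 , (λ e → cong (λ g → mex₂ 0 (mex₂ 0 g)) (even e))

-- The fuel only has to exceed the number of moves still available.
SG-fuel-single : ∀ n f → n < f → SG-fuel f (suc n ∷ []) ≡ grundy (suc n)
SG-fuel-single zero    (suc f) _       = refl
SG-fuel-single (suc n) (suc f) (s≤s n<f)
  rewrite SG-fuel-single n f n<f = mex₂-comm (grundy (suc n)) 0

SG-fuel-ones : ∀ n f → n ≤ f → SG-fuel f (replicate n 1) ≡ grundy n
SG-fuel-ones zero    f       _         = refl
SG-fuel-ones (suc n) (suc f) (s≤s n≤f)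
  rewrite shrink-replicate-1 n | SG-fuel-ones n f n≤f = refl

SG-single : ∀ n → SG (suc n ∷ []) ≡ grundy (suc n)
SG-single n = SG-fuel-single n _ (s≤s (≤-trans (m≤m+n n 0) (m≤m+n (n + 0) 1)))

SG-ones : ∀ n → SG (replicate n 1) ≡ grundy n
SG-ones n = SG-fuel-ones n _
  (subst (λ l → n ≤ sum (replicate n 1) + l) (sym (length-replicate n))
         (m≤n+m n (sum (replicate n 1))))

lemma3p4 : (n : ℕ) → 0 < n →
    IsN (n ∷ []) × IsN (replicate n 1)
    × (n % 2 ≡ 1 → SG (n ∷ []) ≡ 1 × SG (replicate n 1) ≡ 1)
    × (n % 2 ≡ 0 → SG (n ∷ []) ≡ 2 × SG (replicate n 1) ≡ 2)
lemma3p4 (suc n) _ =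
    IsN-if-Move-[] (moveT (suc n) [])
  , IsN-if-Move-[] (subst (Move (replicate (suc n) 1)) (shrink-replicate-1 n)
                          (moveL 1 (replicate n 1)))
  , (λ odd  → both (proj₁ (grundy-parity n) odd))
  , (λ even → both (proj₂ (grundy-parity n) even))
  where
  both : ∀ {v} → grundy (suc n) ≡ v → SG (suc n ∷ []) ≡ v × SG (replicate (suc n) 1) ≡ v
  both g≡v = trans (SG-single n) g≡v , trans (SG-ones (suc n)) g≡v
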